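{- Let $k\ge 3$ be an integer. If $n$ is a positive integer power of $3$, then $f(k,\ell,n)=f(3,\ell,n)=(n+1)/2$ for all integers $\ell\ge 1$.
   Context: A tournament is an orientation of a complete graph. An arborescence is an oriented tree with a designated root such that every vertex of the tree is reachable from the root by a directed path in the tree; its depth is the length of a longest directed path in it. An edge-colored arborescence is path-monochromatic if every directed path in it is monochromatic. For a tournament $T$, $f_T(k,\ell)$ is the largest integer $m$ such that every $k$-edge coloring of $T$ (arbitrary assignment of one of $k$ colors to each edge) contains a path-monochromatic arborescence of depth at most $\ell$ with at least $m$ vertices; $f(k,\ell,n)$ is the minimum of $f_T(k,\ell)$ over all $n$-vertex tournaments $T$. -}

module Defs where

open import Data.Nat using (ℕ; zero; suc; _≤_)
open import Data.Bool using (Bool; true; false; not)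
open import Data.Fin using (Fin)
open import Data.Fin.Subset using (Subset; _∈_; ∣_∣)
open import Data.List using (List; []; _∷_; length)
open import Data.List.Relation.Unary.All using (All)
open import Data.Product using (Σ; ∃; _×_; _,_; proj₁; proj₂)
open import Data.Empty using (⊥)
open import Relation.Binary.PropositionalEquality using (_≡_; _≢_)

record Tournament (n : ℕ) : Set where
  field
    adj      : Fin n → Fin n → Bool
    irrefl   : ∀ i → adj i i ≡ false
    oriented : ∀ i j → i ≢ j → adj i j ≡ not (adj j i)
open Tournament public

-- A k-edge colouring of T assigns a colour in Fin k to each (ordered) pair;
-- only the values on edges of T are relevant.
Colouring : ℕ → ℕ → Set
Colouring n k = Fin n → Fin n → Fin k

-- An arborescence in T: a vertex set, a root, parent pointers and a level
-- function certifying that following parents from any vertex reaches the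
-- root (so the structure is an oriented tree in which every vertex is
-- reachable from the root).
record Arborescence {n : ℕ} (T : Tournament n) : Set where
  field
    verts  : Subset n
    root   : Fin n
    root∈  : root ∈ verts
    par    : Fin n → Fin n
    lvl    : Fin n → ℕ
    lvl-root : lvl root ≡ 0
    par-ok : ∀ v → v ∈ verts → v ≢ root →
             (par v ∈ verts) × (adj T (par v) v ≡ true) × (lvl v ≡ suc (lvl (par v)))
open Arborescence public

TreeEdge : ∀ {n} {T : Tournament n} → Arborescence T → Fin n → Fin n → Set
TreeEdge A u v = (v ∈ verts A) × (v ≢ root A) × (par A v ≡ u)

edgesOf : ∀ {n} → List (Fin n) → List (Fin n × Fin n)
edgesOf []            = []
edgesOf (x ∷ [])      = []
edgesOf (x ∷ y ∷ xs)  = (x , y) ∷ edgesOf (y ∷ xs)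

IsDirPath : ∀ {n} {T : Tournament n} → Arborescence T → List (Fin n) → Set
IsDirPath A []       = ⊥
IsDirPath A (x ∷ xs) = All (λ e → TreeEdge A (proj₁ e) (proj₂ e)) (edgesOf (x ∷ xs))

DepthAtMost : ∀ {n} {T : Tournament n} → Arborescence T → ℕ → Set
DepthAtMost {n} A ℓ = ∀ (p : List (Fin n)) → IsDirPath A p → length (edgesOf p) ≤ ℓ

PathMonochromatic : ∀ {n k} {T : Tournament n} → Colouring n k → Arborescence T → Set
PathMonochromatic {n} {k} c A =
  ∀ (p : List (Fin n)) → IsDirPath A p →
  ∃ λ (col : Fin k) → All (λ e → c (proj₁ e) (proj₂ e) ≡ col) (edgesOf p)

Contains : ∀ {n k} (T : Tournament n) → Colouring n k → ℕ → ℕ → Set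
Contains T c ℓ m = ∃ λ (A : Arborescence T) →
  PathMonochromatic c A × DepthAtMost A ℓ × (m ≤ ∣ verts A ∣)

IsLargest : (ℕ → Set) → ℕ → Set
IsLargest P m = P m × (∀ m' → P m' → m' ≤ m)

IsfT : ∀ {n} → Tournament n → ℕ → ℕ → ℕ → Set
IsfT {n} T k ℓ m = IsLargest (λ m' → ∀ (c : Colouring n k) → Contains T c ℓ m') m

Isf : ℕ → ℕ → ℕ → ℕ → Set
Isf k ℓ n m = (∃ λ (T : Tournament n) → IsfT T k ℓ m)
            × (∀ (T : Tournament n) m' → IsfT T k ℓ m' → m ≤ m')

-- Every tournament on 2d+1 vertices has a vertex of out-degree at least d
-- (double counting), and the star at such a vertex is, for any colouring, a
-- path-monochromatic arborescence of depth 1 with d+1 vertices.  Conversely,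
-- call a colouring transitive if every monochromatic directed path x → y → z
-- forces an edge x → z of the same colour.  For a transitive colouring, in a
-- path-monochromatic arborescence the root dominates every other vertex, so
-- it has at most 1 + outdeg(root) vertices.  Iterating the lexicographic
-- product with the cyclic triangle, colouring every edge between blocks by
-- the block it leaves, gives a regular tournament on 3^j vertices with a
-- transitive 3-colouring, on which the bound d+1 = (3^j+1)/2 is attained.

module Submission where

open import Defs
open import Data.Bool using (Bool; true; false; not; _∧_; _∨_; if_then_else_)
open import Data.Bool.Properties using (∨-zeroʳ; ∨-identityʳ)
open import Data.Empty using (⊥-elim)
open import Data.Fin using (Fin; zero; suc; _↑ˡ_; _↑ʳ_; combine; remQuot; quotient; remainder; inject≤)
open import Data.Fin.Patterns using (0F; 1F; 2F)
open import Data.Fin.Properties using (_≟_; remQuot-combine; combine-remQuot; inject≤-injective)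
open import Data.Fin.Subset using (Subset; _∈_; _⊆_; ∣_∣)
open import Data.Fin.Subset.Properties using (p⊆q⇒∣p∣≤∣q∣)
open import Data.List using ([]; _∷_)
open import Data.List.Relation.Unary.All using (All; []; _∷_)
open import Data.Nat using (ℕ; zero; suc; _≤_; _+_; _*_; _^_; _/_; z≤n; s≤s; _≤?_)
open import Data.Nat.DivMod using (m*n/n≡m)
open import Data.Nat.Properties
  using ( +-*-semiring; +-identityʳ; +-assoc; *-zeroʳ; *-identityˡ; *-identityʳ; +-cancelˡ-≤; +-cancelʳ-≡
        ; *-cancelˡ-≡; +-monoˡ-≤; ≰⇒≥; ≤-refl; ≤-reflexive; ≤-trans; 0≢1+n; suc-injective)
open import Data.Nat.Tactic.RingSolver using (solve-∀)
open import Algebra.Properties.Semiring.Sum +-*-semiring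
  using (sum-syntax; ∑-distrib-+; ∑-comm; *-distribˡ-sum; *-distribʳ-sum; sum-cong-≗)
open import Data.Product using (∃; _×_; _,_; proj₁; proj₂)
open import Data.Vec using (tabulate)
open import Data.Vec.Properties using (lookup∘tabulate; []=⇒lookup; lookup⇒[]=)
open import Function using (_∘_)
open import Function.Definitions using (Injective)
open import Relation.Binary.PropositionalEquality
open import Relation.Nullary using (Dec; yes; no; does; ¬_)
open import Relation.Nullary.Decidable using (dec-true; dec-false)

indicator : Bool → ℕ
indicator true  = 1
indicator false = 0

indicator-∧ : ∀ p q → indicator (p ∧ q) ≡ indicator p * indicator q
indicator-∧ true  q = sym (+-identityʳ (indicator q))
indicator-∧ false q = refl

indicator-∨ : ∀ p q → (p ≡ true → q ≡ false) → indicator (p ∨ q) ≡ indicator p + indicator q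
indicator-∨ true  q p⇒¬q rewrite p⇒¬q refl = refl
indicator-∨ false q _ = refl

∑-const : ∀ n c → ∑[ i < n ] c ≡ n * c
∑-const zero    c = refl
∑-const (suc n) c = cong (c +_) (∑-const n c)

∑-↑ : ∀ m {n} (f : Fin (m + n) → ℕ) →
      ∑[ x < m + n ] f x ≡ ∑[ i < m ] f (i ↑ˡ n) + ∑[ j < n ] f (m ↑ʳ j)
∑-↑ zero    f = refl
∑-↑ (suc m) f = trans (cong (f zero +_) (∑-↑ m (λ x → f (suc x)))) (sym (+-assoc (f zero) _ _))

∑-combine : ∀ a m (f : Fin (a * m) → ℕ) →
            ∑[ x < a * m ] f x ≡ ∑[ b < a ] ∑[ i < m ] f (combine b i)
∑-combine zero    m f = refl
∑-combine (suc a) m f =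
  trans (∑-↑ m {a * m} f)
        (cong (∑[ i < m ] f (combine (zero {a}) i) +_) (∑-combine a m (λ (x : Fin (a * m)) → f (m ↑ʳ x))))

∑-indicator-≟ : ∀ {n} (r : Fin n) → ∑[ s < n ] indicator (does (r ≟ s)) ≡ 1
∑-indicator-≟ {suc n} zero    = cong suc (trans (∑-const n 0) (*-zeroʳ n))
∑-indicator-≟ {suc n} (suc r) = ∑-indicator-≟ r

∑-indicator-≟-* : ∀ {n} (r : Fin n) c → ∑[ s < n ] (indicator (does (r ≟ s)) * c) ≡ c
∑-indicator-≟-* {n} r c = begin
  ∑[ s < n ] (indicator (does (r ≟ s)) * c)  ≡⟨ *-distribʳ-sum c (λ s → indicator (does (r ≟ s))) ⟨
  (∑[ s < n ] indicator (does (r ≟ s))) * c  ≡⟨ cong (_* c) (∑-indicator-≟ r) ⟩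
  1 * c                                      ≡⟨ *-identityˡ c ⟩
  c                                          ∎
  where open ≡-Reasoning

∑-pigeonhole : ∀ n c (f : Fin (suc n) → ℕ) → suc n * c ≤ ∑[ i < suc n ] f i → ∃ λ i → c ≤ f i
∑-pigeonhole zero    c f le = zero , subst₂ _≤_ (+-identityʳ c) (+-identityʳ (f zero)) le
∑-pigeonhole (suc n) c f le with c ≤? f zero
... | yes c≤f₀ = zero , c≤f₀
... | no  c≰f₀ =
  let i , c≤fᵢ = ∑-pigeonhole n c (f ∘ suc) (+-cancelˡ-≤ c _ _ (≤-trans le (+-monoˡ-≤ _ (≰⇒≥ c≰f₀))))
  in suc i , c≤fᵢ

∣tabulate∣ : ∀ {n} (f : Fin n → Bool) → ∣ tabulate f ∣ ≡ ∑[ i < n ] indicator (f i)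
∣tabulate∣ {zero}  f = refl
∣tabulate∣ {suc n} f with f zero
... | true  = cong suc (∣tabulate∣ (λ i → f (suc i)))
... | false = ∣tabulate∣ (λ i → f (suc i))

∈-tabulate⁺ : ∀ {n} {f : Fin n → Bool} {x} → f x ≡ true → x ∈ tabulate f
∈-tabulate⁺ {f = f} {x} fx = lookup⇒[]= x (tabulate f) (trans (lookup∘tabulate f x) fx)

∈-tabulate⁻ : ∀ {n} {f : Fin n → Bool} {x} → x ∈ tabulate f → f x ≡ true
∈-tabulate⁻ {f = f} {x} x∈ = trans (sym (lookup∘tabulate f x)) ([]=⇒lookup x∈)

outdeg : ∀ {n} → Tournament n → Fin n → ℕ
outdeg {n} T r = ∑[ s < n ] indicator (adj T r s)

closedOutNbhd : ∀ {n} → Tournament n → Fin n → Subset n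
closedOutNbhd T r = tabulate (λ s → does (r ≟ s) ∨ adj T r s)

module _ {n} (T : Tournament n) where

  adj-≟-disjoint : ∀ r s → does (r ≟ s) ≡ true → adj T r s ≡ false
  adj-≟-disjoint r s with r ≟ s
  ... | yes refl = λ _ → irrefl T r
  ... | no  _    = λ ()

  ∣closedOutNbhd∣ : ∀ r → ∣ closedOutNbhd T r ∣ ≡ suc (outdeg T r)
  ∣closedOutNbhd∣ r = begin
    ∣ closedOutNbhd T r ∣                                              ≡⟨ ∣tabulate∣ {n} _ ⟩
    ∑[ s < n ] indicator (does (r ≟ s) ∨ adj T r s)                    ≡⟨ sum-cong-≗ {n} (λ s → indicator-∨ _ _ (adj-≟-disjoint r s)) ⟩
    ∑[ s < n ] (indicator (does (r ≟ s)) + indicator (adj T r s))      ≡⟨ ∑-distrib-+ (λ s → indicator (does (r ≟ s))) _ ⟩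
    ∑[ s < n ] indicator (does (r ≟ s)) + outdeg T r                    ≡⟨ cong (_+ outdeg T r) (∑-indicator-≟ r) ⟩
    suc (outdeg T r)                                                    ∎
    where open ≡-Reasoning

  r∈closedOutNbhd : ∀ r → r ∈ closedOutNbhd T r
  r∈closedOutNbhd r = ∈-tabulate⁺ (cong (_∨ adj T r r) (dec-true (r ≟ r) refl))

  out∈closedOutNbhd : ∀ r v → adj T r v ≡ true → v ∈ closedOutNbhd T r
  out∈closedOutNbhd r v rv = ∈-tabulate⁺ (trans (cong (does (r ≟ v) ∨_) rv) (∨-zeroʳ _))

  pair-counted-once : ∀ r s → indicator (adj T r s) + indicator (adj T s r) + indicator (does (r ≟ s)) ≡ 1
  pair-counted-once r s with r ≟ s
  ... | yes refl rewrite irrefl T r = refl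
  ... | no  r≢s  rewrite oriented T r s r≢s with adj T s r
  ...   | true  = refl
  ...   | false = refl

  ∑-outdeg : ∑[ r < n ] outdeg T r + ∑[ r < n ] outdeg T r + n ≡ n * n
  ∑-outdeg = begin
    X + X + n                                              ≡⟨ cong (λ Y → X + Y + n) (∑-comm (λ r s → indicator (adj T r s))) ⟩
    X + ∑[ r < n ] indeg r + n                             ≡⟨ cong (X + ∑[ r < n ] indeg r +_) loops ⟨
    X + ∑[ r < n ] indeg r + ∑[ r < n ] loop r             ≡⟨ cong (_+ ∑[ r < n ] loop r) (∑-distrib-+ (outdeg T) indeg) ⟨
    ∑[ r < n ] (outdeg T r + indeg r) + ∑[ r < n ] loop r  ≡⟨ ∑-distrib-+ (λ r → outdeg T r + indeg r) loop ⟨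
    ∑[ r < n ] (outdeg T r + indeg r + loop r)             ≡⟨ sum-cong-≗ split ⟨
    ∑[ r < n ] ∑[ s < n ] pair r s                         ≡⟨ sum-cong-≗ {n} (λ r → sum-cong-≗ {n} (pair-counted-once r)) ⟩
    ∑[ r < n ] ∑[ s < n ] 1                                ≡⟨ sum-cong-≗ {n} (λ _ → ∑-const n 1) ⟩
    ∑[ r < n ] (n * 1)                                     ≡⟨ ∑-const n (n * 1) ⟩
    n * (n * 1)                                            ≡⟨ cong (n *_) (*-identityʳ n) ⟩
    n * n                                                  ∎
    where
    open ≡-Reasoning
    X : ℕ
    X = ∑[ r < n ] outdeg T r
    indeg loop : Fin n → ℕ
    indeg r = ∑[ s < n ] indicator (adj T s r)
    loop  r = ∑[ s < n ] indicator (does (r ≟ s))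
    pair : Fin n → Fin n → ℕ
    pair r s = indicator (adj T r s) + indicator (adj T s r) + indicator (does (r ≟ s))
    loops : ∑[ r < n ] loop r ≡ n
    loops = trans (sum-cong-≗ {n} (∑-indicator-≟ {n})) (trans (∑-const n 1) (*-identityʳ n))
    split : ∀ r → ∑[ s < n ] pair r s ≡ outdeg T r + indeg r + loop r
    split r = trans (∑-distrib-+ (λ s → indicator (adj T r s) + indicator (adj T s r)) (λ s → indicator (does (r ≟ s))))
                    (cong (_+ loop r) (∑-distrib-+ (λ s → indicator (adj T r s)) (λ s → indicator (adj T s r))))

∃-outdeg-≥ : ∀ {n} d (T : Tournament n) → n ≡ suc (d + d) → ∃ λ r → d ≤ outdeg T r
∃-outdeg-≥ d T refl = ∑-pigeonhole (d + d) d (outdeg T) (≤-reflexive (sym ∑-outdeg≡n*d))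
  where
  n X : ℕ
  n = suc (d + d)
  X = ∑[ r < n ] outdeg T r
  square : ∀ e → suc (e + e) * suc (e + e) ≡ suc (e + e) * e + suc (e + e) * e + suc (e + e)
  square = solve-∀
  ∑-outdeg≡n*d : X ≡ n * d
  ∑-outdeg≡n*d = *-cancelˡ-≡ X (n * d) 2 (begin
    2 * X               ≡⟨ cong (X +_) (+-identityʳ X) ⟩
    X + X               ≡⟨ +-cancelʳ-≡ n _ _ (trans (∑-outdeg T) (square d)) ⟩
    n * d + n * d       ≡⟨ cong (n * d +_) (+-identityʳ (n * d)) ⟨
    2 * (n * d)         ∎)
    where open ≡-Reasoning

module _ {n} (T : Tournament n) (r : Fin n) where

  star : Arborescence T
  star = record
    { verts    = closedOutNbhd T r
    ; root     = r
    ; root∈    = r∈closedOutNbhd T r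
    ; par      = λ _ → r
    ; lvl      = λ v → if does (r ≟ v) then 0 else 1
    ; lvl-root = cong (λ b → if b then 0 else 1) (dec-true (r ≟ r) refl)
    ; par-ok   = λ v v∈ v≢r → r∈closedOutNbhd T r , leaf-adj v∈ v≢r , leaf-lvl v≢r
    }
    where
    leaf-adj : ∀ {v} → v ∈ closedOutNbhd T r → v ≢ r → adj T r v ≡ true
    leaf-adj {v} v∈ v≢r = subst (λ b → b ∨ adj T r v ≡ true) (dec-false (r ≟ v) (v≢r ∘ sym)) (∈-tabulate⁻ v∈)
    leaf-lvl : ∀ {v} → v ≢ r → (if does (r ≟ v) then 0 else 1) ≡ suc (if does (r ≟ r) then 0 else 1)
    leaf-lvl {v} v≢r rewrite dec-false (r ≟ v) (v≢r ∘ sym) | dec-true (r ≟ r) refl = refl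

  star-path-short : ∀ x y z p → ¬ IsDirPath star (x ∷ y ∷ z ∷ p)
  star-path-short x y z p ((_ , y≢r , _) ∷ (_ , _ , r≡y) ∷ _) = y≢r (sym r≡y)

  contains-star : ∀ {k} (c : Colouring n k) ℓ → 1 ≤ ℓ → Contains T c ℓ (suc (outdeg T r))
  contains-star c ℓ 1≤ℓ = star , monochromatic , shallow , ≤-reflexive (sym (∣closedOutNbhd∣ T r))
    where
    monochromatic : PathMonochromatic c star
    monochromatic (x ∷ [])         _ = c x x , []
    monochromatic (x ∷ y ∷ [])     _ = c x y , refl ∷ []
    monochromatic (x ∷ y ∷ z ∷ p)  π = ⊥-elim (star-path-short x y z p π)
    shallow : DepthAtMost star ℓ
    shallow (x ∷ [])        _ = z≤n
    shallow (x ∷ y ∷ [])    _ = 1≤ℓ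
    shallow (x ∷ y ∷ z ∷ p) π = ⊥-elim (star-path-short x y z p π)

contains-half : ∀ {n k} d ℓ (T : Tournament n) (c : Colouring n k) → n ≡ suc (d + d) → 1 ≤ ℓ →
                Contains T c ℓ (suc d)
contains-half d ℓ T c n≡ 1≤ℓ with ∃-outdeg-≥ d T n≡
... | r , d≤outdeg with contains-star T r c ℓ 1≤ℓ
...   | A , monochromatic , shallow , large = A , monochromatic , shallow , ≤-trans (s≤s d≤outdeg) large

TransitiveColouring : ∀ {n k} → Tournament n → Colouring n k → Set
TransitiveColouring T c =
  ∀ x y z → adj T x y ≡ true → adj T y z ≡ true → c x y ≡ c y z → adj T x z ≡ true × c x z ≡ c x y

two-edge-monochromatic : ∀ {n k} (c : Colouring n k) x y z →
  (∃ λ col → All (λ e → c (proj₁ e) (proj₂ e) ≡ col) (edgesOf (x ∷ y ∷ z ∷ []))) → c x y ≡ c y z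
two-edge-monochromatic c x y z (_ , cxy ∷ cyz ∷ []) = trans cxy (sym cyz)

module _ {n k} {T : Tournament n} {c : Colouring n k} (c-trans : TransitiveColouring T c)
         (A : Arborescence T) (monochromatic : PathMonochromatic c A) where

  private
    par∈ : ∀ {v} → v ∈ verts A → v ≢ root A → par A v ∈ verts A
    par∈ v∈ v≢root = proj₁ (par-ok A _ v∈ v≢root)
    par→ : ∀ {v} → v ∈ verts A → v ≢ root A → adj T (par A v) v ≡ true
    par→ v∈ v≢root = proj₁ (proj₂ (par-ok A _ v∈ v≢root))
    lvl-par : ∀ {v} → v ∈ verts A → v ≢ root A → lvl A v ≡ suc (lvl A (par A v))
    lvl-par v∈ v≢root = proj₂ (proj₂ (par-ok A _ v∈ v≢root))

  root-dominates : ∀ t v → lvl A v ≡ t → v ∈ verts A → v ≢ root A →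
                   adj T (root A) v ≡ true × c (root A) v ≡ c (par A v) v
  root-dominates zero v lvl≡0 v∈ v≢root = ⊥-elim (0≢1+n (trans (sym lvl≡0) (lvl-par v∈ v≢root)))
  root-dominates (suc t) v lvl≡ v∈ v≢root with par A v ≟ root A
  ... | yes p≡root = subst (λ u → adj T u v ≡ true) p≡root (par→ v∈ v≢root) , cong (λ u → c u v) (sym p≡root)
  ... | no  p≢root =
    let p = par A v
        root→p , c-root-p = root-dominates t p (suc-injective (trans (sym (lvl-par v∈ v≢root)) lvl≡))
                                           (par∈ v∈ v≢root) p≢root
        c-p≡c-v = two-edge-monochromatic c (par A p) p v
                    (monochromatic (par A p ∷ p ∷ v ∷ [])
                      ((par∈ v∈ v≢root , p≢root , refl) ∷ (v∈ , v≢root , refl) ∷ []))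
        c-root-p≡c-p-v = trans c-root-p c-p≡c-v
        root→v , c-root-v = c-trans (root A) p v root→p (par→ v∈ v≢root) c-root-p≡c-p-v
    in root→v , trans c-root-v c-root-p≡c-p-v

  verts⊆closedOutNbhd : verts A ⊆ closedOutNbhd T (root A)
  verts⊆closedOutNbhd {v} v∈ with v ≟ root A
  ... | yes refl   = r∈closedOutNbhd T v
  ... | no  v≢root = out∈closedOutNbhd T (root A) v (proj₁ (root-dominates _ v refl v∈ v≢root))

  ∣verts∣≤suc-outdeg : ∣ verts A ∣ ≤ suc (outdeg T (root A))
  ∣verts∣≤suc-outdeg = ≤-trans (p⊆q⇒∣p∣≤∣q∣ verts⊆closedOutNbhd) (≤-reflexive (∣closedOutNbhd∣ T (root A)))

Isf-of-transitive-colouring :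
  ∀ {n k ℓ} d → n ≡ suc (d + d) → 1 ≤ ℓ → (T : Tournament n) (c : Colouring n k) →
  TransitiveColouring T c → (∀ r → outdeg T r ≤ d) → Isf k ℓ n (suc d)
Isf-of-transitive-colouring {k = k} {ℓ = ℓ} d n≡ 1≤ℓ T c c-trans outdeg≤d =
  (T , contains-half′ T , at-most) , λ T′ _ (_ , largest) → largest (suc d) (contains-half′ T′)
  where
  contains-half′ : ∀ T′ (c′ : Colouring _ k) → Contains T′ c′ ℓ (suc d)
  contains-half′ T′ c′ = contains-half d ℓ T′ c′ n≡ 1≤ℓ
  at-most : ∀ m → (∀ c′ → Contains T c′ ℓ m) → m ≤ suc d
  at-most m contains with contains c
  ... | A , monochromatic , _ , m≤∣A∣ =
    ≤-trans m≤∣A∣ (≤-trans (∣verts∣≤suc-outdeg c-trans A monochromatic) (s≤s (outdeg≤d (root A))))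

module Lexicographic {a m} (D : Tournament a) (S : Tournament m) where

  block : Fin (a * m) → Fin a
  block = quotient {a} m

  fibre : Fin (a * m) → Fin m
  fibre = remainder {a} m

  block-fibre-injective : ∀ {x y} → block x ≡ block y → fibre x ≡ fibre y → x ≡ y
  block-fibre-injective {x} {y} bx≡by fx≡fy =
    trans (sym (combine-remQuot {a} m x)) (trans (cong₂ combine bx≡by fx≡fy) (combine-remQuot {a} m y))

  lexAdj : Fin (a * m) → Fin (a * m) → Bool
  lexAdj x y = adj D (block x) (block y) ∨ (does (block x ≟ block y) ∧ adj S (fibre x) (fibre y))

  lexAdj-same : ∀ {x y} → block x ≡ block y → lexAdj x y ≡ adj S (fibre x) (fibre y)
  lexAdj-same {x} {y} bx≡by =
    cong₂ (λ p q → p ∨ (q ∧ adj S (fibre x) (fibre y)))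
          (subst (λ b → adj D (block x) b ≡ false) bx≡by (irrefl D (block x)))
          (dec-true (block x ≟ block y) bx≡by)

  lexAdj-diff : ∀ {x y} → block x ≢ block y → lexAdj x y ≡ adj D (block x) (block y)
  lexAdj-diff {x} {y} bx≢by rewrite dec-false (block x ≟ block y) bx≢by = ∨-identityʳ _

  lexicographic : Tournament (a * m)
  lexicographic = record
    { adj      = lexAdj
    ; irrefl   = λ x → trans (lexAdj-same {x} {x} refl) (irrefl S (fibre x))
    ; oriented = oriented-lex
    }
    where
    oriented-lex : ∀ x y → x ≢ y → lexAdj x y ≡ not (lexAdj y x)
    oriented-lex x y x≢y = by-blocks (block x ≟ block y)
      where
      by-blocks : Dec (block x ≡ block y) → lexAdj x y ≡ not (lexAdj y x)
      by-blocks (yes bx≡by) =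
        trans (lexAdj-same bx≡by)
              (trans (oriented S _ _ (x≢y ∘ block-fibre-injective bx≡by)) (cong not (sym (lexAdj-same (sym bx≡by)))))
      by-blocks (no bx≢by) =
        trans (lexAdj-diff bx≢by) (trans (oriented D _ _ bx≢by) (cong not (sym (lexAdj-diff (bx≢by ∘ sym)))))

  indicator-lexAdj : ∀ x b i →
    indicator (lexAdj x (combine b i)) ≡
    indicator (adj D (block x) b) + indicator (does (block x ≟ b)) * indicator (adj S (fibre x) i)
  indicator-lexAdj x b i = begin
    indicator (lexAdj x (combine b i))
      ≡⟨ cong₂ (λ b′ i′ → indicator (adj D (block x) b′ ∨ (does (block x ≟ b′) ∧ adj S (fibre x) i′)))
               (cong proj₁ (remQuot-combine {a} {m} b i)) (cong proj₂ (remQuot-combine {a} {m} b i)) ⟩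
    indicator (adj D (block x) b ∨ (does (block x ≟ b) ∧ adj S (fibre x) i))
      ≡⟨ indicator-∨ _ _ disjoint ⟩
    indicator (adj D (block x) b) + indicator (does (block x ≟ b) ∧ adj S (fibre x) i)
      ≡⟨ cong (indicator (adj D (block x) b) +_) (indicator-∧ (does (block x ≟ b)) (adj S (fibre x) i)) ⟩
    indicator (adj D (block x) b) + indicator (does (block x ≟ b)) * indicator (adj S (fibre x) i)
      ∎
    where
    open ≡-Reasoning
    disjoint : adj D (block x) b ≡ true → does (block x ≟ b) ∧ adj S (fibre x) i ≡ false
    disjoint bx→b = cong (_∧ adj S (fibre x) i) (dec-false (block x ≟ b) no-loop)
      where
      no-loop : block x ≢ b
      no-loop bx≡b with () ← trans (sym (subst (λ β → adj D β b ≡ true) bx≡b bx→b)) (irrefl D b)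

  outdeg-lexicographic : ∀ x → outdeg lexicographic x ≡ m * outdeg D (block x) + outdeg S (fibre x)
  outdeg-lexicographic x = begin
    outdeg lexicographic x
      ≡⟨ ∑-combine a m (λ y → indicator (lexAdj x y)) ⟩
    ∑[ b < a ] ∑[ i < m ] indicator (lexAdj x (combine b i))
      ≡⟨ sum-cong-≗ {a} (λ b → sum-cong-≗ {m} (indicator-lexAdj x b)) ⟩
    ∑[ b < a ] ∑[ i < m ] (δD b + δ b * δS i)
      ≡⟨ sum-cong-≗ {a} (λ b → ∑-distrib-+ (λ _ → δD b) (λ i → δ b * δS i)) ⟩
    ∑[ b < a ] (∑[ i < m ] δD b + ∑[ i < m ] (δ b * δS i))
      ≡⟨ sum-cong-≗ {a} (λ b → cong₂ _+_ (∑-const m (δD b)) (sym (*-distribˡ-sum (δ b) δS))) ⟩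
    ∑[ b < a ] (m * δD b + δ b * outdeg S (fibre x))
      ≡⟨ ∑-distrib-+ (λ b → m * δD b) (λ b → δ b * outdeg S (fibre x)) ⟩
    ∑[ b < a ] (m * δD b) + ∑[ b < a ] (δ b * outdeg S (fibre x))
      ≡⟨ cong₂ _+_ (sym (*-distribˡ-sum m δD)) (∑-indicator-≟-* (block x) (outdeg S (fibre x))) ⟩
    m * outdeg D (block x) + outdeg S (fibre x)
      ∎
    where
    open ≡-Reasoning
    δD δ : Fin a → ℕ
    δD b = indicator (adj D (block x) b)
    δ  b = indicator (does (block x ≟ b))
    δS : Fin m → ℕ
    δS i = indicator (adj S (fibre x) i)

  module _ {k} (ι : Fin a → Fin k) (cS : Colouring m k) where

    lexColour : Colouring (a * m) k
    lexColour x y = if does (block x ≟ block y) then cS (fibre x) (fibre y) else ι (block x)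

    lexColour-same : ∀ {x y} → block x ≡ block y → lexColour x y ≡ cS (fibre x) (fibre y)
    lexColour-same {x} {y} bx≡by rewrite dec-true (block x ≟ block y) bx≡by = refl

    lexColour-diff : ∀ {x y} → block x ≢ block y → lexColour x y ≡ ι (block x)
    lexColour-diff {x} {y} bx≢by rewrite dec-false (block x ≟ block y) bx≢by = refl

    -- Edges leaving distinct blocks have distinct colours, so a monochromatic
    -- path x → y → z changes block at most once.
    lexColour-transitive : Injective _≡_ _≡_ ι → TransitiveColouring S cS →
                           TransitiveColouring lexicographic lexColour
    lexColour-transitive ι-inj cS-trans x y z x→y y→z cxy≡cyz = by-blocks (block x ≟ block y) (block y ≟ block z)
      where
      Goal : Set
      Goal = lexAdj x z ≡ true × lexColour x z ≡ lexColour x y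
      by-blocks : Dec (block x ≡ block y) → Dec (block y ≡ block z) → Goal
      by-blocks (yes bx≡by) (yes by≡bz) =
        let bx≡bz = trans bx≡by by≡bz
            fx→fz , cxz = cS-trans (fibre x) (fibre y) (fibre z)
                            (trans (sym (lexAdj-same {x} {y} bx≡by)) x→y)
                            (trans (sym (lexAdj-same {y} {z} by≡bz)) y→z)
                            (trans (sym (lexColour-same {x} {y} bx≡by)) (trans cxy≡cyz (lexColour-same {y} {z} by≡bz)))
        in trans (lexAdj-same {x} {z} bx≡bz) fx→fz ,
           trans (lexColour-same {x} {z} bx≡bz) (trans cxz (sym (lexColour-same {x} {y} bx≡by)))
      by-blocks (yes bx≡by) (no by≢bz) =
        let bx≢bz = by≢bz ∘ trans (sym bx≡by)
        in trans (lexAdj-diff {x} {z} bx≢bz)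
                 (subst (λ b → adj D b (block z) ≡ true) (sym bx≡by) (trans (sym (lexAdj-diff {y} {z} by≢bz)) y→z)) ,
           trans (lexColour-diff {x} {z} bx≢bz)
                 (trans (cong ι bx≡by) (trans (sym (lexColour-diff {y} {z} by≢bz)) (sym cxy≡cyz)))
      by-blocks (no bx≢by) (yes by≡bz) =
        let bx≢bz = bx≢by ∘ (λ bx≡bz → trans bx≡bz (sym by≡bz))
        in trans (lexAdj-diff {x} {z} bx≢bz)
                 (subst (λ b → adj D (block x) b ≡ true) by≡bz (trans (sym (lexAdj-diff {x} {y} bx≢by)) x→y)) ,
           trans (lexColour-diff {x} {z} bx≢bz) (sym (lexColour-diff {x} {y} bx≢by))
      by-blocks (no bx≢by) (no by≢bz) =
        ⊥-elim (bx≢by (ι-inj (trans (sym (lexColour-diff {x} {y} bx≢by)) (trans cxy≡cyz (lexColour-diff {y} {z} by≢bz)))))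

open Lexicographic using (lexicographic; lexColour; outdeg-lexicographic; lexColour-transitive)

cyclicTriangle : Tournament 3
cyclicTriangle = record { adj = succ-edge ; irrefl = irrefl-cyc ; oriented = oriented-cyc }
  where
  succ-edge : Fin 3 → Fin 3 → Bool
  succ-edge 0F 1F = true
  succ-edge 1F 2F = true
  succ-edge 2F 0F = true
  succ-edge _  _  = false
  irrefl-cyc : ∀ a → succ-edge a a ≡ false
  irrefl-cyc 0F = refl
  irrefl-cyc 1F = refl
  irrefl-cyc 2F = refl
  oriented-cyc : ∀ a b → a ≢ b → succ-edge a b ≡ not (succ-edge b a)
  oriented-cyc 0F 0F a≢b = ⊥-elim (a≢b refl)
  oriented-cyc 0F 1F _ = refl
  oriented-cyc 0F 2F _ = refl
  oriented-cyc 1F 0F _ = refl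
  oriented-cyc 1F 1F a≢b = ⊥-elim (a≢b refl)
  oriented-cyc 1F 2F _ = refl
  oriented-cyc 2F 0F _ = refl
  oriented-cyc 2F 1F _ = refl
  oriented-cyc 2F 2F a≢b = ⊥-elim (a≢b refl)

outdeg-cyclicTriangle : ∀ a → outdeg cyclicTriangle a ≡ 1
outdeg-cyclicTriangle 0F = refl
outdeg-cyclicTriangle 1F = refl
outdeg-cyclicTriangle 2F = refl

singleton : Tournament 1
singleton = record { adj = λ _ _ → false ; irrefl = λ _ → refl ; oriented = λ { 0F 0F 0≢0 → ⊥-elim (0≢0 refl) } }

tower : ∀ j → Tournament (3 ^ j)
tower zero    = singleton
tower (suc j) = lexicographic cyclicTriangle (tower j)

towerColouring : ∀ {k} → (Fin 3 → Fin k) → ∀ j → Colouring (3 ^ j) k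
towerColouring ι zero    = λ _ _ → ι 0F
towerColouring ι (suc j) = lexColour cyclicTriangle (tower j) ι (towerColouring ι j)

towerColouring-transitive : ∀ {k} {ι : Fin 3 → Fin k} → Injective _≡_ _≡_ ι → ∀ j →
                            TransitiveColouring (tower j) (towerColouring ι j)
towerColouring-transitive ι-inj zero    _ _ _ ()
towerColouring-transitive ι-inj (suc j) =
  lexColour-transitive cyclicTriangle (tower j) _ _ ι-inj (towerColouring-transitive ι-inj j)

towerDegree : ℕ → ℕ
towerDegree zero    = 0
towerDegree (suc j) = 3 ^ j + towerDegree j

outdeg-tower : ∀ j x → outdeg (tower j) x ≡ towerDegree j
outdeg-tower zero    _ = refl
outdeg-tower (suc j) x =
  trans (outdeg-lexicographic cyclicTriangle (tower j) x)
        (cong₂ _+_ (trans (cong (3 ^ j *_) (outdeg-cyclicTriangle (block x))) (*-identityʳ (3 ^ j)))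
                   (outdeg-tower j (fibre x)))
  where open Lexicographic cyclicTriangle (tower j) using (block; fibre)

3^≡suc[towerDegree+towerDegree] : ∀ j → 3 ^ j ≡ suc (towerDegree j + towerDegree j)
3^≡suc[towerDegree+towerDegree] zero    = refl
3^≡suc[towerDegree+towerDegree] (suc j) rewrite 3^≡suc[towerDegree+towerDegree] j = triple-odd (towerDegree j)
  where
  triple-odd : ∀ d → 3 * suc (d + d) ≡ suc (suc (d + d) + d + (suc (d + d) + d))
  triple-odd = solve-∀

[3^+1]/2≡suc-towerDegree : ∀ j → (3 ^ j + 1) / 2 ≡ suc (towerDegree j)
[3^+1]/2≡suc-towerDegree j = begin
  (3 ^ j + 1) / 2                               ≡⟨ cong (λ n → (n + 1) / 2) (3^≡suc[towerDegree+towerDegree] j) ⟩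
  (suc (towerDegree j + towerDegree j) + 1) / 2 ≡⟨ cong (_/ 2) (odd+1 (towerDegree j)) ⟩
  suc (towerDegree j) * 2 / 2                   ≡⟨ m*n/n≡m (suc (towerDegree j)) 2 ⟩
  suc (towerDegree j)                           ∎
  where
  open ≡-Reasoning
  odd+1 : ∀ d → suc (d + d) + 1 ≡ suc d * 2
  odd+1 = solve-∀

-- The hypothesis 1 ≤ j is not needed: the case j = 0 (one vertex) holds as well.
lemma3 : ∀ (k ℓ j : ℕ) → 3 ≤ k → 1 ≤ j → 1 ≤ ℓ →
         Isf k ℓ (3 ^ j) ((3 ^ j + 1) / 2) × Isf 3 ℓ (3 ^ j) ((3 ^ j + 1) / 2)
lemma3 k ℓ j 3≤k _ 1≤ℓ rewrite [3^+1]/2≡suc-towerDegree j = Isf-tower 3≤k , Isf-tower ≤-refl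
  where
  Isf-tower : ∀ {k′} → 3 ≤ k′ → Isf k′ ℓ (3 ^ j) (suc (towerDegree j))
  Isf-tower 3≤k′ =
    Isf-of-transitive-colouring (towerDegree j) (3^≡suc[towerDegree+towerDegree] j) 1≤ℓ
      (tower j) (towerColouring (λ a → inject≤ a 3≤k′) j)
      (towerColouring-transitive (inject≤-injective 3≤k′ 3≤k′ _ _) j)
      (λ r → ≤-reflexive (outdeg-tower j r))
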